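{- Let $\Gamma$ be a finite loopless graph (multiple edges allowed), let $k\in\{3,4,5\}$, and suppose $\Gamma_1,\dots,\Gamma_n$ ($n\ge2$) are subgraphs of $\Gamma$ with $\Gamma=\bigcup_{i=1}^n\Gamma_i$. If each $\Gamma_i$ admits a nowhere-zero $k$-flow, and for each $l\in\{2,\dots,n\}$ the graphs $\bigcup_{i=1}^{l-1}\Gamma_i$ and $\Gamma_l$ have at most $k-2$ common edges, then $\Gamma$ admits a nowhere-zero $k$-flow.
   Context: An orientation $\mathcal D$ of a graph assigns each edge one of its two directions; $\mathcal D^+(v)$ (resp. $\mathcal D^-(v)$) is the set of edges with tail (resp. head) at $v$. For an abelian group $A$ and $\varphi:E(\Gamma)\to A$, $(\mathcal D,\varphi)$ is an $A$-flow if $\sum_{e\in\mathcal D^+(v)}\varphi(e)=\sum_{e\in\mathcal D^-(v)}\varphi(e)$ for every vertex $v$, nowhere-zero if $\varphi(e)\neq0$ for all $e$. A nowhere-zero $k$-flow is a nowhere-zero $\mathbb Z$-flow with $|\varphi(e)|<k$ for all edges; a graph has one iff it has a nowhere-zero $\mathbb Z_k$-flow. -}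

module Defs where

open import Data.Nat using (ℕ; zero; suc; _<_; _≤_; _∸_)
open import Data.Integer using (ℤ; ∣_∣) renaming (_+_ to _+ℤ_; 0ℤ to 0ℤ)
open import Data.Fin using (Fin; zero; suc; toℕ; _≟_)
open import Data.Fin.Subset using (Subset; _∈_; _∪_; _∩_; ⊥; ⊤)
open import Data.Fin.Subset.Properties using (_∈?_)
open import Data.Bool using (Bool; true; false; if_then_else_; _∧_)
open import Data.Product using (_×_; Σ; ∃; _,_)
open import Relation.Nullary using (¬_)
open import Relation.Nullary.Decidable using (does)
open import Relation.Binary.PropositionalEquality using (_≡_)

record Graph : Set where
  field
    nv       : ℕ
    ne       : ℕ
    end₁     : Fin ne → Fin nv
    end₂     : Fin ne → Fin nv
    loopless : ∀ e → ¬ (end₁ e ≡ end₂ e)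
open Graph public

Orientation : Graph → Set
Orientation Γ = Fin (ne Γ) → Bool

tail : (Γ : Graph) → Orientation Γ → Fin (ne Γ) → Fin (nv Γ)
tail Γ D e = if D e then end₁ Γ e else end₂ Γ e

head : (Γ : Graph) → Orientation Γ → Fin (ne Γ) → Fin (nv Γ)
head Γ D e = if D e then end₂ Γ e else end₁ Γ e

sumFin : ∀ {m} → (Fin m → ℤ) → ℤ
sumFin {zero}  f = 0ℤ
sumFin {suc m} f = f zero +ℤ sumFin (λ i → f (suc i))

outSum : (Γ : Graph) → Subset (ne Γ) → Orientation Γ → (Fin (ne Γ) → ℤ) → Fin (nv Γ) → ℤ
outSum Γ E D φ x = sumFin (λ e → if does (e ∈? E) ∧ does (tail Γ D e ≟ x) then φ e else 0ℤ)

inSum : (Γ : Graph) → Subset (ne Γ) → Orientation Γ → (Fin (ne Γ) → ℤ) → Fin (nv Γ) → ℤ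
inSum Γ E D φ x = sumFin (λ e → if does (e ∈? E) ∧ does (head Γ D e ≟ x) then φ e else 0ℤ)

record Subgraph (Γ : Graph) : Set where
  field
    V      : Subset (nv Γ)
    E      : Subset (ne Γ)
    closed : ∀ e → e ∈ E → (end₁ Γ e ∈ V) × (end₂ Γ e ∈ V)
open Subgraph public

whole : (Γ : Graph) → Subgraph Γ
whole Γ = record { V = ⊤ ; E = ⊤ ; closed = λ e _ → Data.Fin.Subset.Properties.∈⊤ , Data.Fin.Subset.Properties.∈⊤ }

HasNZkFlow : (Γ : Graph) → Subgraph Γ → ℕ → Set
HasNZkFlow Γ H k =
  Σ (Orientation Γ) λ D → Σ (Fin (ne Γ) → ℤ) λ φ →
    (∀ x → x ∈ V H → outSum Γ (E H) D φ x ≡ inSum Γ (E H) D φ x) ×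
    (∀ e → e ∈ E H → ¬ (φ e ≡ 0ℤ)) ×
    (∀ e → e ∈ E H → ∣ φ e ∣ < k)

unionBelow : ∀ {n m} → (Fin n → Subset m) → ℕ → Subset m
unionBelow {zero}  S l       = ⊥
unionBelow {suc n} S zero    = ⊥
unionBelow {suc n} S (suc l) = S zero ∪ unionBelow (λ i → S (suc i)) l

{-# OPTIONS --safe #-}
module Submission where

-- An integer circulation f with 0 < |f e| < k exactly on the edges of S is a nowhere-zero k-flow on S.
-- By Tutte's lifting lemma every circulation modulo k lifts to an integer one with values in (-k, k)
-- that vanishes exactly where the original is divisible by k; it is proved by pushing the excess ∂f/k
-- along augmenting paths until none is left. So two nowhere-zero k-flows f₁, f₂ sharing at most k - 2
-- edges glue as soon as some combination of them is nonzero modulo k on every shared edge. For k = 3, 5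
-- take f₁ + c f₂ with c ∈ {1, …, k - 1}: as k is prime, each shared edge rules out at most one c. For
-- k = 4 do the same in 𝔽₄ = ℤ₂² with the multipliers 1, ω, ω², which act freely on nonzero values.
-- Adding the subgraphs one at a time gives the theorem.

open import Defs
open import Data.Bool using (Bool; true; false; not; _xor_; if_then_else_; _∧_)
import Data.Bool.Properties as Bool
open import Data.Empty using (⊥-elim)
open import Data.Fin using (Fin; zero; suc; toℕ; fromℕ<; punchIn; _≟_)
open import Data.Fin.Properties using (any?; toℕ-injective; toℕ<n; toℕ-fromℕ<; punchIn-injective; punchInᵢ≢i)
open import Data.Fin.Subset using (Subset; _∈_; _∉_; _∪_; _∩_; ⁅_⁆; ⊥; ⊤; inside; outside) renaming (∣_∣ to size)
open import Data.Fin.Subset.Properties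
  using (_∈?_; ∈⊤; ∉⊥; x∈⁅x⁆; x∈⁅y⁆⇒x≡y; x∈p∪q⁻; x∈p∪q⁺; x∈p∩q⁺; x∈p∩q⁻; drop-there; ∣p∣≤n; p⊂q⇒∣p∣<∣q∣;
         ⊆-antisym; ∪-identityˡ; ∪-identityʳ; ∪-assoc; ∩-zeroˡ; ∣⊥∣≡0)
open import Data.Integer using (ℤ; +_; +[1+_]; -[1+_]; 0ℤ; 1ℤ; -1ℤ; _+_; _*_; -_; _-_; _≤_; _<_; _<?_; ∣_∣; +<+; -<+; -<-)
import Data.Integer.Properties as ℤ
open import Data.Integer.Divisibility.Signed
  using (_∣_; divides; _∣?_; ∣-refl; ∣⇒∣ᵤ; ∣ᵤ⇒∣; ∣m⇒∣-m; ∣m⇒∣m*n; ∣m∣n⇒∣m+n; ∣m∣n⇒∣m-n; ∣m+n∣m⇒∣n; ∣m+n∣n⇒∣m)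
open import Data.Integer.DivMod using (_%ℕ_; _/ℕ_; n%ℕd<d; a≡a%ℕn+[a/ℕn]*n)
open import Data.Integer.Tactic.RingSolver using (solve-∀)
open import Data.Nat as ℕ using (ℕ; zero; suc; _∸_; s≤s; z≤n)
import Data.Nat.Properties as ℕ
import Data.Nat.Divisibility as ℕ
open import Data.Nat.GeneralisedArithmetic using (iterate)
open import Data.Nat.Induction using (<-wellFounded)
open import Data.Nat.Primality using (Prime; prime?; euclidsLemma)
open import Data.Product using (Σ; ∃; _×_; _,_; proj₁; proj₂)
import Data.Product.Properties as Product
open import Data.Sum using (_⊎_; inj₁; inj₂; [_,_]′)
open import Data.Vec using (_∷_; []; here)
open import Function using (_∘_)
open import Induction.WellFounded using (Acc; acc)
open import Relation.Nullary using (¬_; Dec; yes; no; does)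
open import Relation.Nullary.Decidable using (_×-dec_; ¬?; dec-true; dec-false; from-yes)
open import Relation.Binary.PropositionalEquality
open import Algebra.Properties.Semiring.Sum ℤ.+-*-semiring
  using (sum; sum-syntax; sum-cong-≗; sum-replicate-zero; ∑-distrib-+; ∑-comm; *-distribˡ-sum)
import Algebra.Properties.Semiring.Sum ℕ.+-*-semiring as ℕΣ

-- Finite sums

sumFin≡sum : ∀ {m} (f : Fin m → ℤ) → sumFin f ≡ sum f
sumFin≡sum {ℕ.zero}  f = refl
sumFin≡sum {ℕ.suc m} f = cong (_+_ (f zero)) (sumFin≡sum (f ∘ suc))

∑-distrib-- : ∀ {m} (f g : Fin m → ℤ) → ∑[ i < m ] (f i - g i) ≡ sum f - sum g
∑-distrib-- f g = begin
  sum (λ i → f i - g i)          ≡⟨ ∑-distrib-+ f (λ i → - g i) ⟩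
  sum f + sum (λ i → - g i)      ≡⟨ cong (_+_ (sum f)) (sum-cong-≗ (sym ∘ ℤ.-1*i≡-i ∘ g)) ⟩
  sum f + sum (λ i → -1ℤ * g i)  ≡⟨ cong (_+_ (sum f)) (sym (*-distribˡ-sum -1ℤ g)) ⟩
  sum f + -1ℤ * sum g            ≡⟨ cong (_+_ (sum f)) (ℤ.-1*i≡-i (sum g)) ⟩
  sum f - sum g                  ∎
  where open ≡-Reasoning

ι : Bool → ℤ
ι b = if b then 1ℤ else 0ℤ

δ : ∀ {n} → Fin n → Fin n → ℤ
δ a x = ι (does (a ≟ x))

δ-refl : ∀ {n} (a : Fin n) → δ a a ≡ 1ℤ
δ-refl a rewrite dec-true (a ≟ a) refl = refl

δ-≢ : ∀ {n} {a b : Fin n} → a ≢ b → δ a b ≡ 0ℤ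
δ-≢ {a = a} {b} a≢b with a ≟ b
... | yes a≡b = ⊥-elim (a≢b a≡b)
... | no _    = refl

∑-δ : ∀ {m} (a : Fin m) (w : Fin m → ℤ) → ∑[ i < m ] (δ a i * w i) ≡ w a
∑-δ {ℕ.suc m} zero w = begin
  1ℤ * w zero + ∑[ i < m ] (0ℤ * w (suc i))
    ≡⟨ cong₂ _+_ (ℤ.*-identityˡ (w zero)) (sum-cong-≗ (ℤ.*-zeroˡ ∘ w ∘ suc)) ⟩
  w zero + ∑[ i < m ] 0ℤ
    ≡⟨ cong (_+_ (w zero)) (sum-replicate-zero m) ⟩
  w zero + 0ℤ
    ≡⟨ ℤ.+-identityʳ (w zero) ⟩
  w zero ∎
  where open ≡-Reasoning
∑-δ (suc a) w = trans (ℤ.+-identityˡ _) (∑-δ a (w ∘ suc))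

sum-nonneg : ∀ {m} (f : Fin m → ℤ) → (∀ i → 0ℤ ≤ f i) → 0ℤ ≤ sum f
sum-nonneg {ℕ.zero}  f f≥0 = ℤ.≤-refl
sum-nonneg {ℕ.suc m} f f≥0 = ℤ.+-mono-≤ (f≥0 zero) (sum-nonneg (f ∘ suc) (f≥0 ∘ suc))

sum-nonpos : ∀ {m} (f : Fin m → ℤ) → (∀ i → f i ≤ 0ℤ) → sum f ≤ 0ℤ
sum-nonpos {ℕ.zero}  f f≤0 = ℤ.≤-refl
sum-nonpos {ℕ.suc m} f f≤0 = ℤ.+-mono-≤ (f≤0 zero) (sum-nonpos (f ∘ suc) (f≤0 ∘ suc))

sum-pos : ∀ {m} (f : Fin m → ℤ) → (∀ i → 0ℤ ≤ f i) → ∀ j → 0ℤ < f j → 0ℤ < sum f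
sum-pos f f≥0 zero    0<fj = ℤ.+-mono-<-≤ 0<fj (sum-nonneg (f ∘ suc) (f≥0 ∘ suc))
sum-pos f f≥0 (suc j) 0<fj = ℤ.+-mono-≤-< (f≥0 zero) (sum-pos (f ∘ suc) (f≥0 ∘ suc) j 0<fj)

sum-neg : ∀ {m} (f : Fin m → ℤ) → (∀ i → f i ≤ 0ℤ) → ∀ j → f j < 0ℤ → sum f < 0ℤ
sum-neg f f≤0 zero    fj<0 = ℤ.+-mono-<-≤ fj<0 (sum-nonpos (f ∘ suc) (f≤0 ∘ suc))
sum-neg f f≤0 (suc j) fj<0 = ℤ.+-mono-≤-< (f≤0 zero) (sum-neg (f ∘ suc) (f≤0 ∘ suc) j fj<0)

sum-nonpos-≡0 : ∀ {m} (f : Fin m → ℤ) → (∀ i → f i ≤ 0ℤ) → sum f ≡ 0ℤ → ∀ i → f i ≡ 0ℤ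
sum-nonpos-≡0 f f≤0 ∑f≡0 i = ℤ.≤-antisym (f≤0 i) (ℤ.≮⇒≥ λ fi<0 → ℤ.<⇒≢ (sum-neg f f≤0 i fi<0) ∑f≡0)

ℕΣ-mono-≤ : ∀ {m} (f g : Fin m → ℕ) → (∀ i → f i ℕ.≤ g i) → ℕΣ.sum f ℕ.≤ ℕΣ.sum g
ℕΣ-mono-≤ {zero}  f g f≤g = z≤n
ℕΣ-mono-≤ {suc m} f g f≤g = ℕ.+-mono-≤ (f≤g zero) (ℕΣ-mono-≤ (f ∘ suc) (g ∘ suc) (f≤g ∘ suc))

ℕΣ-mono-< : ∀ {m} (f g : Fin m → ℕ) → (∀ i → f i ℕ.≤ g i) → ∀ j → f j ℕ.< g j → ℕΣ.sum f ℕ.< ℕΣ.sum g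
ℕΣ-mono-< f g f≤g zero    fj<gj = ℕ.+-mono-<-≤ fj<gj (ℕΣ-mono-≤ (f ∘ suc) (g ∘ suc) (f≤g ∘ suc))
ℕΣ-mono-< f g f≤g (suc j) fj<gj = ℕ.+-mono-≤-< (f≤g zero) (ℕΣ-mono-< (f ∘ suc) (g ∘ suc) (f≤g ∘ suc) j fj<gj)

-- Boundaries and circulations

Edge Vertex : Graph → Set
Edge Γ = Fin (ne Γ)
Vertex Γ = Fin (nv Γ)

module _ (Γ : Graph) where

  incidence : Edge Γ → Vertex Γ → ℤ
  incidence e x = δ (end₁ Γ e) x - δ (end₂ Γ e) x

  ∂ : (Edge Γ → ℤ) → Vertex Γ → ℤ
  ∂ f x = ∑[ e < ne Γ ] (incidence e x * f e)

  IsCirculation : (Edge Γ → ℤ) → Set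
  IsCirculation f = ∀ x → ∂ f x ≡ 0ℤ

  ∂-cong : ∀ {f g} → (∀ e → f e ≡ g e) → ∀ x → ∂ f x ≡ ∂ g x
  ∂-cong f≗g x = sum-cong-≗ (cong (incidence _ x *_) ∘ f≗g)

  ∂-+ : ∀ f g x → ∂ (λ e → f e + g e) x ≡ ∂ f x + ∂ g x
  ∂-+ f g x = trans (sum-cong-≗ (λ e → ℤ.*-distribˡ-+ (incidence e x) (f e) (g e)))
                    (∑-distrib-+ (λ e → incidence e x * f e) (λ e → incidence e x * g e))

  ∂-* : ∀ c f x → ∂ (λ e → c * f e) x ≡ c * ∂ f x
  ∂-* c f x = trans (sum-cong-≗ (λ e → swap (incidence e x) c (f e)))
                    (sym (*-distribˡ-sum c (λ e → incidence e x * f e)))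
    where
    swap : ∀ a b d → a * (b * d) ≡ b * (a * d)
    swap = solve-∀

  ∂-δ : ∀ e x → ∂ (δ e) x ≡ incidence e x
  ∂-δ e x = trans (sum-cong-≗ (λ e′ → ℤ.*-comm (incidence e′ x) (δ e e′))) (∑-δ e (λ e′ → incidence e′ x))

  ∑-weighted-∂ : ∀ (w : Vertex Γ → ℤ) f →
    ∑[ x < nv Γ ] (w x * ∂ f x) ≡ ∑[ e < ne Γ ] ((w (end₁ Γ e) - w (end₂ Γ e)) * f e)
  ∑-weighted-∂ w f = begin
    ∑[ x < nv Γ ] (w x * ∂ f x)
      ≡⟨ sum-cong-≗ (λ x → *-distribˡ-sum (w x) (λ e → incidence e x * f e)) ⟩
    ∑[ x < nv Γ ] ∑[ e < ne Γ ] (w x * (incidence e x * f e))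
      ≡⟨ ∑-comm (λ x e → w x * (incidence e x * f e)) ⟩
    ∑[ e < ne Γ ] ∑[ x < nv Γ ] (w x * (incidence e x * f e))
      ≡⟨ sum-cong-≗ edge ⟩
    ∑[ e < ne Γ ] ((w (end₁ Γ e) - w (end₂ Γ e)) * f e) ∎
    where
    open ≡-Reasoning
    expand : ∀ a i j d → a * ((i - j) * d) ≡ i * (a * d) - j * (a * d)
    expand = solve-∀
    collect : ∀ a b d → a * d - b * d ≡ (a - b) * d
    collect = solve-∀
    edge : ∀ e → ∑[ x < nv Γ ] (w x * (incidence e x * f e)) ≡ (w (end₁ Γ e) - w (end₂ Γ e)) * f e
    edge e = begin
      ∑[ x < nv Γ ] (w x * (incidence e x * f e))
        ≡⟨ sum-cong-≗ (λ x → expand (w x) (δ (end₁ Γ e) x) (δ (end₂ Γ e) x) (f e)) ⟩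
      ∑[ x < nv Γ ] (δ (end₁ Γ e) x * (w x * f e) - δ (end₂ Γ e) x * (w x * f e))
        ≡⟨ ∑-distrib-- (λ x → δ (end₁ Γ e) x * (w x * f e)) (λ x → δ (end₂ Γ e) x * (w x * f e)) ⟩
      ∑[ x < nv Γ ] (δ (end₁ Γ e) x * (w x * f e)) - ∑[ x < nv Γ ] (δ (end₂ Γ e) x * (w x * f e))
        ≡⟨ cong₂ _-_ (∑-δ (end₁ Γ e) _) (∑-δ (end₂ Γ e) _) ⟩
      w (end₁ Γ e) * f e - w (end₂ Γ e) * f e
        ≡⟨ collect (w (end₁ Γ e)) (w (end₂ Γ e)) (f e) ⟩
      (w (end₁ Γ e) - w (end₂ Γ e)) * f e ∎

  ∑-∂ : ∀ f → ∑[ x < nv Γ ] ∂ f x ≡ 0ℤ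
  ∑-∂ f = begin
    ∑[ x < nv Γ ] ∂ f x              ≡⟨ sum-cong-≗ (sym ∘ ℤ.*-identityˡ ∘ ∂ f) ⟩
    ∑[ x < nv Γ ] (1ℤ * ∂ f x)       ≡⟨ ∑-weighted-∂ (λ _ → 1ℤ) f ⟩
    ∑[ e < ne Γ ] ((1ℤ - 1ℤ) * f e)    ≡⟨ sum-cong-≗ (ℤ.*-zeroˡ ∘ f) ⟩
    ∑[ e < ne Γ ] 0ℤ                   ≡⟨ sum-replicate-zero (ne Γ) ⟩
    0ℤ                                 ∎
    where open ≡-Reasoning

  +-circulation : ∀ {f g} → IsCirculation f → IsCirculation g → IsCirculation (λ e → f e + g e)
  +-circulation {f} {g} ∂f≡0 ∂g≡0 x = trans (∂-+ f g x) (cong₂ _+_ (∂f≡0 x) (∂g≡0 x))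

  *-circulation : ∀ c {f} → IsCirculation f → IsCirculation (λ e → c * f e)
  *-circulation c {f} ∂f≡0 x = trans (∂-* c f x) (trans (cong (c *_) (∂f≡0 x)) (ℤ.*-zeroʳ c))

  circulation-cong : ∀ {f g} → (∀ e → f e ≡ g e) → IsCirculation f → IsCirculation g
  circulation-cong f≗g ∂f≡0 x = trans (sym (∂-cong f≗g x)) (∂f≡0 x)

  zero-circulation : IsCirculation (λ _ → 0ℤ)
  zero-circulation x = trans (sum-cong-≗ (λ e → ℤ.*-zeroʳ (incidence e x))) (sum-replicate-zero (ne Γ))

  record NZFlow (k : ℕ) (S : Subset (ne Γ)) : Set where
    constructor nzFlow
    field
      flow        : Edge Γ → ℤ
      circulation : IsCirculation flow
      zero-off    : ∀ e → e ∉ S → flow e ≡ 0ℤ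
      nonzero-on  : ∀ e → e ∈ S → flow e ≢ 0ℤ
      bounded     : ∀ e → e ∈ S → ∣ flow e ∣ ℕ.< k

-- Flows given by an orientation

ι-split : ∀ a b p → (ι a - ι b) * p ≡ (if a then p else 0ℤ) - (if b then p else 0ℤ)
ι-split true  true  p = trans (ℤ.*-zeroˡ p) (sym (ℤ.+-inverseʳ p))
ι-split true  false p = trans (ℤ.*-identityˡ p) (sym (ℤ.+-identityʳ p))
ι-split false true  p = trans (ℤ.-1*i≡-i p) (sym (ℤ.+-identityˡ (- p)))
ι-split false false p = ℤ.*-zeroˡ p

ι-split-neg : ∀ a b p → (ι a - ι b) * - p ≡ (if b then p else 0ℤ) - (if a then p else 0ℤ)
ι-split-neg a b p = trans (flip (ι a) (ι b) p) (ι-split b a p)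
  where
  flip : ∀ i j q → (i - j) * - q ≡ (j - i) * q
  flip = solve-∀

module _ {Γ : Graph} where

  -- The flow (D, φ) on the edges of S, read along the reference directions end₁ Γ e → end₂ Γ e.
  signed : Subset (ne Γ) → Orientation Γ → (Edge Γ → ℤ) → Edge Γ → ℤ
  signed S D φ e = if does (e ∈? S) then (if D e then φ e else - φ e) else 0ℤ

  private
    outTerm inTerm : Subset (ne Γ) → Orientation Γ → (Edge Γ → ℤ) → Vertex Γ → Edge Γ → ℤ
    outTerm S D φ x e = if does (e ∈? S) ∧ does (tail Γ D e ≟ x) then φ e else 0ℤ
    inTerm  S D φ x e = if does (e ∈? S) ∧ does (head Γ D e ≟ x) then φ e else 0ℤ

    incidence-signed : ∀ S D φ x e →
      incidence Γ e x * signed S D φ e ≡ outTerm S D φ x e - inTerm S D φ x e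
    incidence-signed S D φ x e with e ∈? S | D e
    ... | no _  | _     = ℤ.*-zeroʳ (incidence Γ e x)
    ... | yes _ | true  = ι-split (does (end₁ Γ e ≟ x)) (does (end₂ Γ e ≟ x)) (φ e)
    ... | yes _ | false = ι-split-neg (does (end₁ Γ e ≟ x)) (does (end₂ Γ e ≟ x)) (φ e)

    sumFin-zero : ∀ (f : Edge Γ → ℤ) → (∀ e → f e ≡ 0ℤ) → sumFin f ≡ 0ℤ
    sumFin-zero f f≡0 = trans (sumFin≡sum f) (trans (sum-cong-≗ f≡0) (sum-replicate-zero (ne Γ)))

  ∂-signed : ∀ S D φ x → ∂ Γ (signed S D φ) x ≡ outSum Γ S D φ x - inSum Γ S D φ x
  ∂-signed S D φ x = begin
    ∂ Γ (signed S D φ) x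
      ≡⟨ sum-cong-≗ (incidence-signed S D φ x) ⟩
    ∑[ e < ne Γ ] (outTerm S D φ x e - inTerm S D φ x e)
      ≡⟨ ∑-distrib-- (outTerm S D φ x) (inTerm S D φ x) ⟩
    sum (outTerm S D φ x) - sum (inTerm S D φ x)
      ≡⟨ sym (cong₂ _-_ (sumFin≡sum (outTerm S D φ x)) (sumFin≡sum (inTerm S D φ x))) ⟩
    outSum Γ S D φ x - inSum Γ S D φ x ∎
    where open ≡-Reasoning

  module _ (H : Subgraph Γ) (D : Orientation Γ) (φ : Edge Γ → ℤ) {x : Vertex Γ} (x∉H : x ∉ V H) where

    private
      term-off-H : (end : Edge Γ → Vertex Γ) → (∀ e → e ∈ E H → end e ∈ V H) →
        ∀ e → (if does (e ∈? E H) ∧ does (end e ≟ x) then φ e else 0ℤ) ≡ 0ℤ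
      term-off-H end end∈H e with e ∈? E H
      ... | no _ = refl
      ... | yes e∈H with end e ≟ x
      ...   | yes refl = ⊥-elim (x∉H (end∈H e e∈H))
      ...   | no _     = refl

      tail∈H : ∀ e → e ∈ E H → tail Γ D e ∈ V H
      tail∈H e e∈H with D e
      ... | true  = proj₁ (closed H e e∈H)
      ... | false = proj₂ (closed H e e∈H)

      head∈H : ∀ e → e ∈ E H → head Γ D e ∈ V H
      head∈H e e∈H with D e
      ... | true  = proj₂ (closed H e e∈H)
      ... | false = proj₁ (closed H e e∈H)

    outSum-off-H : outSum Γ (E H) D φ x ≡ 0ℤ
    outSum-off-H = sumFin-zero _ (term-off-H (tail Γ D) tail∈H)

    inSum-off-H : inSum Γ (E H) D φ x ≡ 0ℤ
    inSum-off-H = sumFin-zero _ (term-off-H (head Γ D) head∈H)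

  HasNZkFlow⇒NZFlow : ∀ H k → HasNZkFlow Γ H k → NZFlow Γ k (E H)
  HasNZkFlow⇒NZFlow H k (D , φ , conserved , nonzero , bounded) =
    nzFlow (signed (E H) D φ) circulation zero-off nonzero-on bounded′
    where
    circulation : IsCirculation Γ (signed (E H) D φ)
    circulation x with x ∈? V H
    ... | yes x∈H = trans (∂-signed (E H) D φ x)
                      (trans (cong (_- inSum Γ (E H) D φ x) (conserved x x∈H)) (ℤ.+-inverseʳ (inSum Γ (E H) D φ x)))
    ... | no x∉H  = trans (∂-signed (E H) D φ x) (cong₂ _-_ (outSum-off-H H D φ x∉H) (inSum-off-H H D φ x∉H))
    zero-off : ∀ e → e ∉ E H → signed (E H) D φ e ≡ 0ℤ
    zero-off e e∉H with e ∈? E H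
    ... | yes e∈H = ⊥-elim (e∉H e∈H)
    ... | no _    = refl
    nonzero-on : ∀ e → e ∈ E H → signed (E H) D φ e ≢ 0ℤ
    nonzero-on e e∈H with e ∈? E H
    ... | no e∉H = ⊥-elim (e∉H e∈H)
    ... | yes _ with D e
    ...   | true  = nonzero e e∈H
    ...   | false = nonzero e e∈H ∘ ℤ.neg-injective
    bounded′ : ∀ e → e ∈ E H → ∣ signed (E H) D φ e ∣ ℕ.< k
    bounded′ e e∈H with e ∈? E H
    ... | no e∉H = ⊥-elim (e∉H e∈H)
    ... | yes _ with D e
    ...   | true  = bounded e e∈H
    ...   | false = subst (ℕ._< k) (sym (ℤ.∣-i∣≡∣i∣ (φ e))) (bounded e e∈H)

  NZFlow⇒HasNZkFlow : ∀ {k} → NZFlow Γ k ⊤ → HasNZkFlow Γ (whole Γ) k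
  NZFlow⇒HasNZkFlow (nzFlow f circulation _ nonzero-on bounded) =
    (λ _ → true) , f , conserved , (λ e _ → nonzero-on e ∈⊤) , bounded
    where
    signed≗f : ∀ e → signed ⊤ (λ _ → true) f e ≡ f e
    signed≗f e rewrite dec-true (e ∈? ⊤) ∈⊤ = refl
    conserved : ∀ x → x ∈ ⊤ → outSum Γ ⊤ (λ _ → true) f x ≡ inSum Γ ⊤ (λ _ → true) f x
    conserved x _ = ℤ.i-j≡0⇒i≡j _ _
      (trans (sym (∂-signed ⊤ (λ _ → true) f x)) (trans (∂-cong Γ signed≗f x) (circulation x)))

-- Tutte's lifting lemma

module Lifting (Γ : Graph) where

  Inside : Subset (nv Γ) → Edge Γ → Set
  Inside R e = end₁ Γ e ∈ R × end₂ Γ e ∈ R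

  data Push (f : Edge Γ → ℤ) (e : Edge Γ) (u v : Vertex Γ) : Set where
    forward  : 0ℤ < f e → end₁ Γ e ≡ u → end₂ Γ e ≡ v → Push f e u v
    backward : f e < 0ℤ → end₂ Γ e ≡ u → end₁ Γ e ≡ v → Push f e u v

  Push-resp : ∀ {f f′ e u v} → f′ e ≡ f e → Push f e u v → Push f′ e u v
  Push-resp eq (forward  pos a b) = forward  (subst (0ℤ <_) (sym eq) pos) a b
  Push-resp eq (backward neg a b) = backward (subst (_< 0ℤ) (sym eq) neg) a b

  Push-not-inside : ∀ {f e u v} R → v ∉ R → Push f e u v → ¬ Inside R e
  Push-not-inside R v∉R (forward  _ _ refl) (_ , v∈R) = v∉R v∈R
  Push-not-inside R v∉R (backward _ _ refl) (v∈R , _) = v∉R v∈R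

  Push-inside : ∀ {f e u v} R → u ∈ R → Push f e u v → Inside (R ∪ ⁅ v ⁆) e
  Push-inside {v = v} R u∈R (forward  _ refl refl) = x∈p∪q⁺ (inj₁ u∈R) , x∈p∪q⁺ (inj₂ (x∈⁅x⁆ v))
  Push-inside {v = v} R u∈R (backward _ refl refl) = x∈p∪q⁺ (inj₂ (x∈⁅x⁆ v)) , x∈p∪q⁺ (inj₁ u∈R)

  push? : ∀ f R e → Dec (∃ λ u → ∃ λ v → u ∈ R × v ∉ R × Push f e u v)
  push? f R e with (0ℤ <? f e) ×-dec (end₁ Γ e ∈? R) ×-dec ¬? (end₂ Γ e ∈? R)
                 | (f e <? 0ℤ) ×-dec (end₂ Γ e ∈? R) ×-dec ¬? (end₁ Γ e ∈? R)
  ... | yes (pos , u∈R , v∉R) | _ = yes (_ , _ , u∈R , v∉R , forward pos refl refl)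
  ... | no _ | yes (neg , u∈R , v∉R) = yes (_ , _ , u∈R , v∉R , backward neg refl refl)
  ... | no ¬fwd | no ¬bwd = no λ where
    (_ , _ , u∈R , v∉R , forward  pos refl refl) → ¬fwd (pos , u∈R , v∉R)
    (_ , _ , u∈R , v∉R , backward neg refl refl) → ¬bwd (neg , u∈R , v∉R)

  ∑-∂-closed : ∀ f R → (∀ e u v → u ∈ R → v ∉ R → ¬ Push f e u v) →
    ∑[ x < nv Γ ] (ι (does (x ∈? R)) * ∂ Γ f x) ≤ 0ℤ
  ∑-∂-closed f R closed = subst (_≤ 0ℤ) (sym (∑-weighted-∂ Γ 1R f))
    (sum-nonpos (λ e → (1R (end₁ Γ e) - 1R (end₂ Γ e)) * f e) λ e → term e (end₁ Γ e ∈? R) (end₂ Γ e ∈? R))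
    where
    1R : Vertex Γ → ℤ
    1R x = ι (does (x ∈? R))
    term : ∀ e → (a : Dec (end₁ Γ e ∈ R)) (b : Dec (end₂ Γ e ∈ R)) → (ι (does a) - ι (does b)) * f e ≤ 0ℤ
    term e (yes _)   (yes _)   = ℤ.≤-reflexive (ℤ.*-zeroˡ (f e))
    term e (no _)    (no _)    = ℤ.≤-reflexive (ℤ.*-zeroˡ (f e))
    term e (yes u∈R) (no v∉R)  = subst (_≤ 0ℤ) (sym (ℤ.*-identityˡ (f e)))
      (ℤ.≮⇒≥ λ pos → closed e _ _ u∈R v∉R (forward pos refl refl))
    term e (no v∉R)  (yes u∈R) = subst (_≤ 0ℤ) (sym (ℤ.-1*i≡-i (f e)))
      (ℤ.neg-mono-≤ (ℤ.≮⇒≥ λ neg → closed e _ _ u∈R v∉R (backward neg refl refl)))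

  module _ (k′ : ℕ) (g : Edge Γ → ℤ) where

    k : ℕ
    k = suc k′

    K : ℤ
    K = + k

    record Candidate (f : Edge Γ → ℤ) : Set where
      field
        congruent : ∀ e → K ∣ f e - g e
        above     : ∀ e → - K < f e
        below     : ∀ e → f e < K
    open Candidate

    step : ∀ {f e u v} → Push f e u v → ℤ
    step (forward  _ _ _) = - K
    step (backward _ _ _) = K

    pushed : ∀ {f e u v} → Push f e u v → Edge Γ → ℤ
    pushed {f} {e} p e′ = f e′ + step p * δ e e′

    pushed-at : ∀ {f e u v} (p : Push f e u v) → pushed p e ≡ f e + step p
    pushed-at {f} {e} p = trans (cong (λ d → f e + step p * d) (δ-refl e)) (cong (_+_ (f e)) (ℤ.*-identityʳ (step p)))

    pushed-elsewhere : ∀ {f e u v} (p : Push f e u v) {e′} → e′ ≢ e → pushed p e′ ≡ f e′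
    pushed-elsewhere {f} {e} p {e′} e′≢e = begin
      f e′ + step p * δ e e′ ≡⟨ cong (λ d → f e′ + step p * d) (δ-≢ (e′≢e ∘ sym)) ⟩
      f e′ + step p * 0ℤ     ≡⟨ cong (_+_ (f e′)) (ℤ.*-zeroʳ (step p)) ⟩
      f e′ + 0ℤ              ≡⟨ ℤ.+-identityʳ (f e′) ⟩
      f e′                   ∎
      where open ≡-Reasoning

    ∂-pushed : ∀ {f e u v} (p : Push f e u v) x → ∂ Γ (pushed p) x ≡ ∂ Γ f x - K * δ u x + K * δ v x
    ∂-pushed {f} {e} {u} {v} p x = begin
      ∂ Γ (pushed p) x                              ≡⟨ ∂-+ Γ f (λ e′ → step p * δ e e′) x ⟩
      ∂ Γ f x + ∂ Γ (λ e′ → step p * δ e e′) x      ≡⟨ cong (_+_ (∂ Γ f x)) (∂-* Γ (step p) (δ e) x) ⟩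
      ∂ Γ f x + step p * ∂ Γ (δ e) x                ≡⟨ cong (λ d → ∂ Γ f x + step p * d) (∂-δ Γ e x) ⟩
      ∂ Γ f x + step p * incidence Γ e x            ≡⟨ redistribute p ⟩
      ∂ Γ f x - K * δ u x + K * δ v x               ∎
      where
      open ≡-Reasoning
      forwards : ∀ a i j c → a + - c * (i - j) ≡ a - c * i + c * j
      forwards = solve-∀
      backwards : ∀ a i j c → a + c * (j - i) ≡ a - c * i + c * j
      backwards = solve-∀
      redistribute : ∀ {u v} (p : Push f e u v) →
        ∂ Γ f x + step p * incidence Γ e x ≡ ∂ Γ f x - K * δ u x + K * δ v x
      redistribute (forward  _ refl refl) = forwards  (∂ Γ f x) _ _ K
      redistribute (backward _ refl refl) = backwards (∂ Γ f x) _ _ K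

    pushed-pointwise : ∀ {f e u v} (p : Push f e u v) (P : Edge Γ → ℤ → Set) →
      P e (f e + step p) → (∀ e′ → e′ ≢ e → P e′ (f e′)) → ∀ e′ → P e′ (pushed p e′)
    pushed-pointwise {e = e} p P at-e elsewhere e′ with e′ ≟ e
    ... | yes refl  = subst (P e) (sym (pushed-at p)) at-e
    ... | no  e′≢e = subst (P e′) (sym (pushed-elsewhere p e′≢e)) (elsewhere e′ e′≢e)

    private
      lower-by-K : ∀ {a} → 0ℤ < a → a < K → - K < a - K × a - K < K
      lower-by-K {a} 0<a a<K = subst (_< a - K) (ℤ.+-identityˡ (- K)) (ℤ.+-monoˡ-< (- K) 0<a)
                             , ℤ.<-trans (subst (a - K <_) (ℤ.+-inverseʳ K) (ℤ.+-monoˡ-< (- K) a<K)) (+<+ (s≤s z≤n))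

      raise-by-K : ∀ {a} → - K < a → a < 0ℤ → - K < a + K × a + K < K
      raise-by-K {a} -K<a a<0 = ℤ.<-trans -<+ (subst (_< a + K) (ℤ.+-inverseˡ K) (ℤ.+-monoˡ-< K -K<a))
                              , subst (a + K <_) (ℤ.+-identityˡ K) (ℤ.+-monoˡ-< K a<0)

      K∣step : ∀ {f e u v} (p : Push f e u v) → K ∣ step p
      K∣step (forward  _ _ _) = ∣m⇒∣-m ∣-refl
      K∣step (backward _ _ _) = ∣-refl

    pushed-candidate : ∀ {f e u v} (p : Push f e u v) → Candidate f → Candidate (pushed p)
    pushed-candidate {f} {e} p c = record
      { congruent = pushed-pointwise p (λ e′ a → K ∣ a - g e′)
                      (subst (K ∣_) (regroup (f e) (g e) (step p)) (∣m∣n⇒∣m+n (congruent c e) (K∣step p)))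
                      (λ e′ _ → congruent c e′)
      ; above     = pushed-pointwise p (λ _ a → - K < a) (proj₁ (shifted p)) (λ e′ _ → above c e′)
      ; below     = pushed-pointwise p (λ _ a → a < K) (proj₂ (shifted p)) (λ e′ _ → below c e′)
      }
      where
      regroup : ∀ a b d → a - b + d ≡ a + d - b
      regroup = solve-∀
      shifted : ∀ {u v} (p : Push f e u v) → - K < f e + step p × f e + step p < K
      shifted (forward  0<fe _ _) = lower-by-K 0<fe (below c e)
      shifted (backward fe<0 _ _) = raise-by-K (above c e) fe<0

    candidate-∂ : ∀ {f} → (∀ x → K ∣ ∂ Γ g x) → Candidate f → ∀ x → K ∣ ∂ Γ f x
    candidate-∂ {f} K∣∂g c x = subst (K ∣_) (sym ∂f) (∣m∣n⇒∣m+n (K∣∂g x) (∣m⇒∣m*n (∂ Γ q x) ∣-refl))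
      where
      q : Edge Γ → ℤ
      q e = _∣_.quotient (congruent c e)
      split : ∀ e → f e ≡ g e + K * q e
      split e = trans (split-off (f e) (g e)) (cong (_+_ (g e)) (trans (_∣_.equality (congruent c e)) (ℤ.*-comm (q e) K)))
        where
        split-off : ∀ a b → a ≡ b + (a - b)
        split-off = solve-∀
      ∂f : ∂ Γ f x ≡ ∂ Γ g x + K * ∂ Γ q x
      ∂f = trans (∂-cong Γ split x) (trans (∂-+ Γ g (λ e → K * q e) x) (cong (_+_ (∂ Γ g x)) (∂-* Γ K q x)))

    module Search (f : Edge Γ → ℤ) (candidate : Candidate f) (ν : Vertex Γ → ℤ) (s : Vertex Γ) where

      -- f′ is f pushed along a path from s to x running inside R.
      Reach : Subset (nv Γ) → Vertex Γ → Set
      Reach R x = Σ (Edge Γ → ℤ) λ f′ → Candidate f′ ×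
        (∀ y → ∂ Γ f′ y ≡ ∂ Γ f y - K * δ s y + K * δ x y) × (∀ e → ¬ Inside R e → f′ e ≡ f e)

      data Outcome : Set where
        found : ∀ {R} t → ν t < 0ℤ → Reach R t → Outcome
        stuck : ∀ R → s ∈ R → (∀ x → x ∈ R → 0ℤ ≤ ν x) →
                (∀ e u v → u ∈ R → v ∉ R → ¬ Push f e u v) → Outcome

      reach-start : Reach ⁅ s ⁆ s
      reach-start = f , candidate , (λ y → cancel (∂ Γ f y) (K * δ s y)) , (λ _ _ → refl)
        where
        cancel : ∀ a b → a ≡ a - b + b
        cancel = solve-∀

      reach-extend : ∀ {R e u v} → u ∈ R → v ∉ R → Push f e u v → Reach R u → Reach (R ∪ ⁅ v ⁆) v
      reach-extend {R} {e} {u} {v} u∈R v∉R p (f′ , c′ , ∂f′ , agree) =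
        pushed p′ , pushed-candidate p′ c′ , ∂f″ , agree′
        where
        p′ : Push f′ e u v
        p′ = Push-resp (agree e (Push-not-inside R v∉R p)) p
        telescope : ∀ a b i j l → a - b * i + b * j - b * j + b * l ≡ a - b * i + b * l
        telescope = solve-∀
        ∂f″ : ∀ y → ∂ Γ (pushed p′) y ≡ ∂ Γ f y - K * δ s y + K * δ v y
        ∂f″ y = begin
          ∂ Γ (pushed p′) y                                   ≡⟨ ∂-pushed p′ y ⟩
          ∂ Γ f′ y - K * δ u y + K * δ v y                    ≡⟨ cong (λ a → a - K * δ u y + K * δ v y) (∂f′ y) ⟩
          ∂ Γ f y - K * δ s y + K * δ u y - K * δ u y + K * δ v y ≡⟨ telescope (∂ Γ f y) K (δ s y) (δ u y) (δ v y) ⟩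
          ∂ Γ f y - K * δ s y + K * δ v y                     ∎
          where open ≡-Reasoning
        agree′ : ∀ e′ → ¬ Inside (R ∪ ⁅ v ⁆) e′ → pushed p′ e′ ≡ f e′
        agree′ e′ not-inside with e′ ≟ e
        ... | yes refl  = ⊥-elim (not-inside (Push-inside R u∈R p))
        ... | no  e′≢e = trans (pushed-elsewhere p′ e′≢e)
                           (agree e′ λ (a , b) → not-inside (x∈p∪q⁺ (inj₁ a) , x∈p∪q⁺ (inj₁ b)))

      reach-weaken : ∀ {R x} v → Reach R x → Reach (R ∪ ⁅ v ⁆) x
      reach-weaken {R} {x} v (f′ , c′ , ∂f′ , agree) =
        f′ , c′ , ∂f′ , λ e not-inside → agree e λ (a , b) → not-inside (x∈p∪q⁺ (inj₁ a) , x∈p∪q⁺ (inj₁ b))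

      search : ∀ R → Acc ℕ._<_ (nv Γ ∸ size R) → s ∈ R → (∀ x → x ∈ R → Reach R x) → Outcome
      search R (acc smaller) s∈R reach with any? (λ x → (x ∈? R) ×-dec (ν x <? 0ℤ))
      ... | yes (t , t∈R , νt<0) = found t νt<0 (reach t t∈R)
      ... | no ¬negative with any? (push? f R)
      ...   | no ¬push = stuck R s∈R (λ x x∈R → ℤ.≮⇒≥ λ νx<0 → ¬negative (x , x∈R , νx<0))
                           (λ e u v u∈R v∉R p → ¬push (e , u , v , u∈R , v∉R , p))
      ...   | yes (e , u , v , u∈R , v∉R , p) =
        search (R ∪ ⁅ v ⁆) (smaller (ℕ.∸-monoʳ-< grows (∣p∣≤n (R ∪ ⁅ v ⁆)))) (x∈p∪q⁺ (inj₁ s∈R)) reach′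
        where
        grows : size R ℕ.< size (R ∪ ⁅ v ⁆)
        grows = p⊂q⇒∣p∣<∣q∣ ((λ x∈R → x∈p∪q⁺ (inj₁ x∈R)) , v , x∈p∪q⁺ (inj₂ (x∈⁅x⁆ v)) , v∉R)
        reach′ : ∀ x → x ∈ R ∪ ⁅ v ⁆ → Reach (R ∪ ⁅ v ⁆) x
        reach′ x x∈R′ with x∈p∪q⁻ R ⁅ v ⁆ x∈R′
        ... | inj₁ x∈R = reach-weaken {R} {x} v (reach x x∈R)
        ... | inj₂ x∈v rewrite x∈⁅y⁆⇒x≡y v x∈v = reach-extend u∈R v∉R p (reach u u∈R)

    open Search using (found; stuck)

    private
      K*-nonneg : ∀ {a} → 0ℤ ≤ a → 0ℤ ≤ K * a
      K*-nonneg {a} 0≤a = subst (_≤ K * a) (ℤ.*-zeroʳ K) (ℤ.*-monoˡ-≤-nonNeg K 0≤a)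

      K*-pos : ∀ {a} → 0ℤ < a → 0ℤ < K * a
      K*-pos {a} 0<a = subst (_< K * a) (ℤ.*-zeroʳ K) (ℤ.*-monoˡ-<-pos K 0<a)

    stuck-impossible : ∀ {f : Edge Γ → ℤ} {ν : Vertex Γ → ℤ} {s} → (∀ x → ∂ Γ f x ≡ K * ν x) → 0ℤ < ν s →
      ∀ R → s ∈ R → (∀ x → x ∈ R → 0ℤ ≤ ν x) → ¬ (∀ e u v → u ∈ R → v ∉ R → ¬ Push f e u v)
    stuck-impossible {f} {ν} {s} ∂≡Kν 0<νs R s∈R ν≥0 closed = ℤ.<⇒≱ inflow (∑-∂-closed f R closed)
      where
      1R : Vertex Γ → ℤ
      1R x = ι (does (x ∈? R))
      term≥0 : ∀ x → 0ℤ ≤ 1R x * (K * ν x)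
      term≥0 x with x ∈? R
      ... | yes x∈R = subst (0ℤ ≤_) (sym (ℤ.*-identityˡ (K * ν x))) (K*-nonneg (ν≥0 x x∈R))
      ... | no  _   = ℤ.≤-refl
      term-s>0 : 0ℤ < 1R s * (K * ν s)
      term-s>0 = subst (λ a → 0ℤ < a * (K * ν s)) (sym (cong ι (dec-true (s ∈? R) s∈R)))
                   (subst (0ℤ <_) (sym (ℤ.*-identityˡ (K * ν s))) (K*-pos 0<νs))
      inflow : 0ℤ < ∑[ x < nv Γ ] (1R x * ∂ Γ f x)
      inflow = subst (0ℤ <_) (sum-cong-≗ λ x → cong (1R x *_) (sym (∂≡Kν x)))
                 (sum-pos (λ x → 1R x * (K * ν x)) term≥0 s term-s>0)

    ∑-excess≡0 : ∀ {f : Edge Γ → ℤ} (ν : Vertex Γ → ℤ) → (∀ x → ∂ Γ f x ≡ K * ν x) → sum ν ≡ 0ℤ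
    ∑-excess≡0 {f} ν ∂≡Kν = ℤ.*-cancelˡ-≡ K (sum ν) 0ℤ (begin
      K * sum ν               ≡⟨ *-distribˡ-sum K ν ⟩
      ∑[ x < nv Γ ] (K * ν x) ≡⟨ sum-cong-≗ (sym ∘ ∂≡Kν) ⟩
      ∑[ x < nv Γ ] ∂ Γ f x   ≡⟨ ∑-∂ Γ f ⟩
      0ℤ                      ≡⟨ sym (ℤ.*-zeroʳ K) ⟩
      K * 0ℤ                  ∎)
      where open ≡-Reasoning

    total-excess : (Vertex Γ → ℤ) → ℕ
    total-excess ν = ℕΣ.sum (λ x → ∣ ν x ∣)

    total-excess-moved : ∀ ν {s t} → 0ℤ < ν s → ν t < 0ℤ →
      total-excess (λ y → ν y - δ s y + δ t y) ℕ.< total-excess ν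
    total-excess-moved ν {s} {t} 0<νs νt<0 = ℕΣ-mono-< _ _ (λ y → by-cases y (s ≟ y) (t ≟ y)) s at-s
      where
      s≢t : s ≢ t
      s≢t refl = ℤ.<-asym 0<νs νt<0
      decrement : ∀ {a} → 0ℤ < a → ∣ a - 1ℤ ∣ ℕ.< ∣ a ∣
      decrement {+[1+ n ]} _ = ℕ.n<1+n n
      decrement {+ zero} (+<+ ())
      increment : ∀ {a} → a < 0ℤ → ∣ a + 1ℤ ∣ ℕ.< ∣ a ∣
      increment { -[1+ zero ]}  _ = s≤s z≤n
      increment { -[1+ suc n ]} _ = ℕ.n<1+n (suc n)
      increment {+ n} (+<+ ())
      moved : ∀ y {i j} → δ s y ≡ i → δ t y ≡ j → ν y - δ s y + δ t y ≡ ν y - i + j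
      moved y = cong₂ (λ i j → ν y - i + j)
      at-s : ∣ ν s - δ s s + δ t s ∣ ℕ.< ∣ ν s ∣
      at-s = subst (λ a → ∣ a ∣ ℕ.< ∣ ν s ∣)
               (sym (trans (moved s (δ-refl s) (δ-≢ (s≢t ∘ sym))) (ℤ.+-identityʳ (ν s - 1ℤ)))) (decrement 0<νs)
      by-cases : ∀ y → Dec (s ≡ y) → Dec (t ≡ y) → ∣ ν y - δ s y + δ t y ∣ ℕ.≤ ∣ ν y ∣
      by-cases y (yes refl) _          = ℕ.<⇒≤ at-s
      by-cases y (no s≢y)  (yes refl) = ℕ.<⇒≤ (subst (λ a → ∣ a ∣ ℕ.< ∣ ν t ∣)
                                         (sym (trans (moved t (δ-≢ s≢y) (δ-refl t)) (cong (_+ 1ℤ) (ℤ.+-identityʳ (ν t)))))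
                                         (increment νt<0))
      by-cases y (no s≢y)  (no t≢y)  = ℕ.≤-reflexive (cong ∣_∣ (trans (moved y (δ-≢ s≢y) (δ-≢ t≢y))
                                         (trans (ℤ.+-identityʳ (ν y - 0ℤ)) (ℤ.+-identityʳ (ν y)))))

    cancel-excess : ∀ f → Candidate f → ∀ ν → (∀ x → ∂ Γ f x ≡ K * ν x) → Acc ℕ._<_ (total-excess ν) →
      Σ (Edge Γ → ℤ) λ f′ → Candidate f′ × IsCirculation Γ f′
    cancel-excess f c ν ∂≡Kν (acc smaller) with any? (λ x → 0ℤ <? ν x)
    ... | no ¬positive = f , c , λ x → trans (∂≡Kν x) (trans (cong (K *_) (ν≡0 x)) (ℤ.*-zeroʳ K))
      where
      ν≡0 : ∀ x → ν x ≡ 0ℤ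
      ν≡0 = sum-nonpos-≡0 ν (λ x → ℤ.≮⇒≥ λ 0<νx → ¬positive (x , 0<νx)) (∑-excess≡0 ν ∂≡Kν)
    ... | yes (s , 0<νs) with Search.search f c ν s ⁅ s ⁆ (<-wellFounded _) (x∈⁅x⁆ s) start
      where
      start : ∀ x → x ∈ ⁅ s ⁆ → Search.Reach f c ν s ⁅ s ⁆ x
      start x x∈s rewrite x∈⁅y⁆⇒x≡y s x∈s = Search.reach-start f c ν s
    ...   | stuck R s∈R ν≥0 closed = ⊥-elim (stuck-impossible ∂≡Kν 0<νs R s∈R ν≥0 closed)
    ...   | found t νt<0 (f′ , c′ , ∂f′ , _) =
      cancel-excess f′ c′ ν′ ∂f′≡Kν′ (smaller (total-excess-moved ν 0<νs νt<0))
      where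
      ν′ : Vertex Γ → ℤ
      ν′ y = ν y - δ s y + δ t y
      factor : ∀ a i j → K * a - K * i + K * j ≡ K * (a - i + j)
      factor = solve-∀
      ∂f′≡Kν′ : ∀ y → ∂ Γ f′ y ≡ K * ν′ y
      ∂f′≡Kν′ y = trans (∂f′ y)
        (trans (cong (λ a → a - K * δ s y + K * δ t y) (∂≡Kν y)) (factor (ν y) (δ s y) (δ t y)))

    initial-candidate : Candidate (λ e → + (g e %ℕ k))
    initial-candidate = record
      { congruent = λ e → divides (- (g e /ℕ k)) (remainder (g e))
      ; above     = λ e → -<+
      ; below     = λ e → +<+ (n%ℕd<d (g e) k)
      }
      where
      remainder : ∀ a → + (a %ℕ k) - a ≡ - (a /ℕ k) * K
      remainder a = begin
        + (a %ℕ k) - a                              ≡⟨ cong (_-_ (+ (a %ℕ k))) (a≡a%ℕn+[a/ℕn]*n a k) ⟩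
        + (a %ℕ k) - (+ (a %ℕ k) + (a /ℕ k) * K)    ≡⟨ cancel (+ (a %ℕ k)) (a /ℕ k) K ⟩
        - (a /ℕ k) * K                              ∎
        where
        open ≡-Reasoning
        cancel : ∀ r q d → r - (r + q * d) ≡ - q * d
        cancel = solve-∀

    lift : (∀ x → K ∣ ∂ Γ g x) → Σ (Edge Γ → ℤ) λ f → Candidate f × IsCirculation Γ f
    lift K∣∂g = cancel-excess f₀ initial-candidate ν₀ ∂≡Kν₀ (<-wellFounded _)
      where
      f₀ : Edge Γ → ℤ
      f₀ e = + (g e %ℕ k)
      ν₀ : Vertex Γ → ℤ
      ν₀ x = _∣_.quotient (candidate-∂ K∣∂g initial-candidate x)
      ∂≡Kν₀ : ∀ x → ∂ Γ f₀ x ≡ K * ν₀ x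
      ∂≡Kν₀ x = trans (_∣_.equality (candidate-∂ K∣∂g initial-candidate x)) (ℤ.*-comm (ν₀ x) K)

LiftMod : (Γ : Graph) → ℕ → (Edge Γ → ℤ) → Set
LiftMod Γ k g = Σ (Edge Γ → ℤ) λ f → IsCirculation Γ f × (∀ e → + k ∣ f e - g e) × (∀ e → ∣ f e ∣ ℕ.< k)

lift-mod : ∀ {Γ} (k : ℕ) .{{_ : ℕ.NonZero k}} (g : Edge Γ → ℤ) → (∀ x → + k ∣ ∂ Γ g x) → LiftMod Γ k g
lift-mod {Γ} (suc k′) g k∣∂g with Lifting.lift Γ k′ g k∣∂g
... | f , c , circulation = f , circulation , congruent , λ e → abs-bound (above e) (below e)
  where
  open Lifting.Candidate c
  abs-bound : ∀ {a} → - + suc k′ < a → a < + suc k′ → ∣ a ∣ ℕ.< suc k′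
  abs-bound {+ n}      _          (+<+ n<k) = n<k
  abs-bound { -[1+ n ]} (-<- n<k′) _        = s≤s n<k′

-- Gluing two flows

size-∷ : ∀ {n} s (T : Subset n) → size T ℕ.≤ size (s ∷ T)
size-∷ inside  T = ℕ.n≤1+n (size T)
size-∷ outside T = ℕ.≤-refl

unblocked-choice : ∀ {n m} (T : Subset n) (Blocks : Fin n → Fin m → Set) → (∀ e c → Dec (Blocks e c)) →
  (∀ {e c} → Blocks e c → e ∈ T) → (∀ {e c c′} → Blocks e c → Blocks e c′ → c ≡ c′) →
  size T ℕ.< m → ∃ λ c → ∀ e → ¬ Blocks e c
unblocked-choice [] _ _ _ _ (s≤s _) = zero , λ ()
unblocked-choice (s ∷ T) Blocks blocks? ∈T unique |sT|<m with any? (blocks? zero)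
... | no unblocked-by-0
  with unblocked-choice T (Blocks ∘ suc) (blocks? ∘ suc) (drop-there ∘ ∈T) unique (ℕ.≤-<-trans (size-∷ s T) |sT|<m)
...   | c , free = c , λ { zero b → unblocked-by-0 (c , b) ; (suc e) b → free e b }
unblocked-choice (s ∷ T) Blocks blocks? ∈T unique |sT|<m | yes (c₀ , b₀) with ∈T b₀ | |sT|<m
...   | here | s≤s |T|<m′
  with unblocked-choice T (λ e c → Blocks (suc e) (punchIn c₀ c)) (λ e c → blocks? (suc e) (punchIn c₀ c))
         (drop-there ∘ ∈T) (λ b b′ → punchIn-injective c₀ _ _ (unique b b′)) |T|<m′
...     | c , free = punchIn c₀ c , λ { zero b → punchInᵢ≢i c₀ c (unique b b₀) ; (suc e) b → free e b }

module _ {k : ℕ} where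

  small-divisible⇒0 : ∀ {a} → ∣ a ∣ ℕ.< k → + k ∣ a → a ≡ 0ℤ
  small-divisible⇒0 {a} |a|<k k∣a with ∣ a ∣ in |a|≡
  ... | zero  = ℤ.∣i∣≡0⇒i≡0 |a|≡
  ... | suc _ = ⊥-elim (ℕ.<⇒≱ |a|<k (ℕ.∣⇒≤ (subst (k ℕ.∣_) |a|≡ (∣⇒∣ᵤ k∣a))))

  small-nonzero⇒∤ : ∀ {a} → ∣ a ∣ ℕ.< k → a ≢ 0ℤ → ¬ (+ k ∣ a)
  small-nonzero⇒∤ |a|<k a≢0 = a≢0 ∘ small-divisible⇒0 |a|<k

  congruent-zero : ∀ {a b} → + k ∣ a - b → + k ∣ b → ∣ a ∣ ℕ.< k → a ≡ 0ℤ
  congruent-zero {a} {b} k∣a-b k∣b |a|<k = small-divisible⇒0 |a|<k (subst (+ k ∣_) (cancel a b) (∣m∣n⇒∣m+n k∣a-b k∣b))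
    where
    cancel : ∀ a b → a - b + b ≡ a
    cancel = solve-∀

  congruent-to-zero : ∀ {a b} → + k ∣ a - b → a ≡ 0ℤ → + k ∣ b
  congruent-to-zero {b = b} k∣a-b refl =
    subst (+ k ∣_) (trans (cong -_ (ℤ.+-identityˡ (- b))) (ℤ.neg-involutive b)) (∣m⇒∣-m k∣a-b)

  congruent-nonzero : ∀ {a b} → + k ∣ a - b → ¬ (+ k ∣ b) → a ≢ 0ℤ
  congruent-nonzero k∣a-b k∤b = k∤b ∘ congruent-to-zero k∣a-b

euclid-ℤ : ∀ {p} → Prime p → ∀ a b → (+ p) ∣ a * b → ((+ p) ∣ a) ⊎ ((+ p) ∣ b)
euclid-ℤ {p} p-prime a b p∣ab
  with euclidsLemma ∣ a ∣ ∣ b ∣ p-prime (subst (p ℕ.∣_) (ℤ.∣i*j∣≡∣i∣*∣j∣ a b) (∣⇒∣ᵤ p∣ab))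
... | inj₁ p∣a = inj₁ (∣ᵤ⇒∣ p∣a)
... | inj₂ p∣b = inj₂ (∣ᵤ⇒∣ p∣b)

lift-NZFlow : ∀ {Γ} (k : ℕ) .{{_ : ℕ.NonZero k}} (S : Subset (ne Γ)) (g : Edge Γ → ℤ) → IsCirculation Γ g →
  (∀ e → e ∉ S → + k ∣ g e) → (∀ e → e ∈ S → ¬ (+ k ∣ g e)) → NZFlow Γ k S
lift-NZFlow {Γ} k S g circulation-g k∣off k∤on with lift-mod {Γ} k g (λ x → divides 0ℤ (circulation-g x))
... | f , circulation , congruent , bounded =
  nzFlow f circulation (λ e e∉S → congruent-zero (congruent e) (k∣off e e∉S) (bounded e))
                       (λ e e∈S → congruent-nonzero (congruent e) (k∤on e e∈S)) (λ e _ → bounded e)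

Glues : Graph → ℕ → Set
Glues Γ k = ∀ {S₁ S₂} → NZFlow Γ k S₁ → NZFlow Γ k S₂ → size (S₁ ∩ S₂) ℕ.≤ k ∸ 2 → NZFlow Γ k (S₁ ∪ S₂)

prime-glues : ∀ {Γ p} → Prime p → Glues Γ p
prime-glues {p = 0} ()
prime-glues {p = 1} ()
prime-glues {Γ} {p@(suc (suc p′))} p-prime {S₁} {S₂}
  (nzFlow f₁ circulation₁ zero-off₁ nonzero-on₁ bounded₁) (nzFlow f₂ circulation₂ zero-off₂ nonzero-on₂ bounded₂) few =
  glue-along (proj₁ chosen) (proj₂ chosen)
  where
  P : ℤ
  P = + p
  multiplier : Fin (suc p′) → ℤ
  multiplier c = + suc (toℕ c)
  P∤multiplier : ∀ c → ¬ (P ∣ multiplier c)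
  P∤multiplier c = small-nonzero⇒∤ (s≤s (toℕ<n c)) λ ()
  multiplier-injective : ∀ {c c′} → P ∣ multiplier c - multiplier c′ → c ≡ c′
  multiplier-injective {c} {c′} P∣m-m′ =
    toℕ-injective (ℕ.suc-injective (ℤ.+-injective (ℤ.i-j≡0⇒i≡j _ _ (small-divisible⇒0 |m-m′|<p P∣m-m′))))
    where
    |m-m′|<p : ∣ multiplier c - multiplier c′ ∣ ℕ.< p
    |m-m′|<p = s≤s (ℕ.≤-trans (ℤ.∣m⊝n∣≤m⊔n (suc (toℕ c)) (suc (toℕ c′))) (ℕ.⊔-lub (toℕ<n c) (toℕ<n c′)))
  P∤f₂ : ∀ {e} → e ∈ S₂ → ¬ (P ∣ f₂ e)
  P∤f₂ e∈S₂ = small-nonzero⇒∤ (bounded₂ _ e∈S₂) (nonzero-on₂ _ e∈S₂)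
  combination : Fin (suc p′) → Edge Γ → ℤ
  combination c e = f₁ e + multiplier c * f₂ e
  Blocks : Edge Γ → Fin (suc p′) → Set
  Blocks e c = e ∈ S₁ ∩ S₂ × P ∣ combination c e
  unique : ∀ {e c c′} → Blocks e c → Blocks e c′ → c ≡ c′
  unique {e} {c} {c′} (e∈T , P∣c) (_ , P∣c′)
    with euclid-ℤ p-prime (multiplier c - multiplier c′) (f₂ e)
           (subst (P ∣_) (difference (f₁ e) (f₂ e) (multiplier c) (multiplier c′)) (∣m∣n⇒∣m-n P∣c P∣c′))
    where
    difference : ∀ a b m m′ → (a + m * b) - (a + m′ * b) ≡ (m - m′) * b
    difference = solve-∀
  ... | inj₁ P∣m-m′ = multiplier-injective P∣m-m′
  ... | inj₂ P∣f₂   = ⊥-elim (P∤f₂ (proj₂ (x∈p∩q⁻ S₁ S₂ e∈T)) P∣f₂)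
  chosen = unblocked-choice (S₁ ∩ S₂) Blocks (λ e c → (e ∈? S₁ ∩ S₂) ×-dec (P ∣? combination c e))
             proj₁ unique (s≤s few)
  glue-along : ∀ c → (∀ e → ¬ Blocks e c) → NZFlow Γ p (S₁ ∪ S₂)
  glue-along c free =
    lift-NZFlow p (S₁ ∪ S₂) (combination c)
      (+-circulation Γ circulation₁ (*-circulation Γ (multiplier c) circulation₂)) P∣off P∤on
    where
    P∣off : ∀ e → e ∉ S₁ ∪ S₂ → P ∣ combination c e
    P∣off e e∉S = subst (P ∣_) (sym vanishes) (divides 0ℤ refl)
      where
      vanishes : combination c e ≡ 0ℤ
      vanishes = begin
        f₁ e + multiplier c * f₂ e ≡⟨ cong₂ (λ a b → a + multiplier c * b)
                                        (zero-off₁ e (e∉S ∘ x∈p∪q⁺ ∘ inj₁)) (zero-off₂ e (e∉S ∘ x∈p∪q⁺ ∘ inj₂)) ⟩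
        0ℤ + multiplier c * 0ℤ     ≡⟨ ℤ.+-identityˡ _ ⟩
        multiplier c * 0ℤ          ≡⟨ ℤ.*-zeroʳ (multiplier c) ⟩
        0ℤ                         ∎
        where open ≡-Reasoning
    P∤on : ∀ e → e ∈ S₁ ∪ S₂ → ¬ (P ∣ combination c e)
    P∤on e e∈S with e ∈? S₁ | e ∈? S₂
    ... | yes e∈S₁ | yes e∈S₂ = λ P∣ → free e (x∈p∩q⁺ (e∈S₁ , e∈S₂) , P∣)
    ... | yes e∈S₁ | no e∉S₂  =
      subst (λ a → ¬ (P ∣ a)) (sym only₁) (small-nonzero⇒∤ (bounded₁ e e∈S₁) (nonzero-on₁ e e∈S₁))
      where
      only₁ : combination c e ≡ f₁ e
      only₁ = trans (cong (λ b → f₁ e + multiplier c * b) (zero-off₂ e e∉S₂))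
                    (trans (cong (_+_ (f₁ e)) (ℤ.*-zeroʳ (multiplier c))) (ℤ.+-identityʳ (f₁ e)))
    ... | no e∉S₁ | yes e∈S₂  = λ P∣ →
      [ P∤multiplier c , P∤f₂ e∈S₂ ]′ (euclid-ℤ p-prime (multiplier c) (f₂ e) (subst (P ∣_) only₂ P∣))
      where
      only₂ : combination c e ≡ multiplier c * f₂ e
      only₂ = trans (cong (_+ multiplier c * f₂ e) (zero-off₁ e e∉S₁)) (ℤ.+-identityˡ _)
    ... | no e∉S₁ | no e∉S₂   = ⊥-elim ([ e∉S₁ , e∉S₂ ]′ (x∈p∪q⁻ S₁ S₂ e∈S))

-- Parities and 𝔽₄

odd : ℤ → Bool
odd a = not (does (+ 2 ∣? a))

even⇒¬odd : ∀ {a} → + 2 ∣ a → odd a ≡ false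
even⇒¬odd {a} 2∣a = cong not (dec-true (+ 2 ∣? a) 2∣a)

¬even⇒odd : ∀ {a} → ¬ (+ 2 ∣ a) → odd a ≡ true
¬even⇒odd {a} 2∤a = cong not (dec-false (+ 2 ∣? a) 2∤a)

¬odd⇒even : ∀ a → odd a ≡ false → + 2 ∣ a
¬odd⇒even a = from-dec (+ 2 ∣? a)
  where
  from-dec : (d : Dec (+ 2 ∣ a)) → not (does d) ≡ false → + 2 ∣ a
  from-dec (yes 2∣a) _ = 2∣a

¬even⇒even-pred : ∀ {a} → ¬ (+ 2 ∣ a) → + 2 ∣ a - 1ℤ
¬even⇒even-pred {a} 2∤a with a %ℕ 2 | n%ℕd<d a 2 | a≡a%ℕn+[a/ℕn]*n a 2
... | 0 | _ | a≡ = ⊥-elim (2∤a (divides (a /ℕ 2) (trans a≡ (ℤ.+-identityˡ _))))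
... | 1 | _ | a≡ = divides (a /ℕ 2) (trans (cong (_- 1ℤ) a≡) (cancel (a /ℕ 2)))
  where
  cancel : ∀ q → 1ℤ + q * + 2 - 1ℤ ≡ q * + 2
  cancel = solve-∀
... | suc (suc _) | s≤s (s≤s ()) | _

odd-+ : ∀ a b → odd (a + b) ≡ odd a xor odd b
odd-+ a b with + 2 ∣? a | + 2 ∣? b
... | yes 2∣a | yes 2∣b = trans (even⇒¬odd (∣m∣n⇒∣m+n 2∣a 2∣b)) (sym (cong₂ _xor_ (even⇒¬odd 2∣a) (even⇒¬odd 2∣b)))
... | yes 2∣a | no 2∤b  = trans (¬even⇒odd λ 2∣a+b → 2∤b (∣m+n∣m⇒∣n 2∣a+b 2∣a))
                                (sym (cong₂ _xor_ (even⇒¬odd 2∣a) (¬even⇒odd 2∤b)))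
... | no 2∤a  | yes 2∣b = trans (¬even⇒odd λ 2∣a+b → 2∤a (∣m+n∣n⇒∣m 2∣a+b 2∣b))
                                (sym (cong₂ _xor_ (¬even⇒odd 2∤a) (even⇒¬odd 2∣b)))
... | no 2∤a  | no 2∤b  = trans (even⇒¬odd (subst (+ 2 ∣_) (regroup a b)
                                  (∣m∣n⇒∣m+n (∣m∣n⇒∣m+n (¬even⇒even-pred 2∤a) (¬even⇒even-pred 2∤b)) (divides 1ℤ refl))))
                                (sym (cong₂ _xor_ (¬even⇒odd 2∤a) (¬even⇒odd 2∤b)))
  where
  regroup : ∀ a b → a - 1ℤ + (b - 1ℤ) + + 2 ≡ a + b
  regroup = solve-∀

𝔽₂² : Set
𝔽₂² = Bool × Bool

𝟘 : 𝔽₂²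
𝟘 = false , false

_⊕_ : 𝔽₂² → 𝔽₂² → 𝔽₂²
(x , y) ⊕ (x′ , y′) = x xor x′ , y xor y′

⊕-identityʳ : ∀ u → u ⊕ 𝟘 ≡ u
⊕-identityʳ (x , y) = cong₂ _,_ (Bool.xor-identityʳ x) (Bool.xor-identityʳ y)

⊕-cancel : ∀ u {a b} → u ⊕ a ≡ 𝟘 → u ⊕ b ≡ 𝟘 → a ≡ b
⊕-cancel (x , y) {a₁ , a₂} {b₁ , b₂} ua≡𝟘 ub≡𝟘 =
  cong₂ _,_ (xor-cancel x (cong proj₁ ua≡𝟘) (cong proj₁ ub≡𝟘)) (xor-cancel y (cong proj₂ ua≡𝟘) (cong proj₂ ub≡𝟘))
  where
  xor-cancel : ∀ x {a b} → x xor a ≡ false → x xor b ≡ false → a ≡ b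
  xor-cancel false refl refl = refl
  xor-cancel true {true} {true} _ _ = refl

-- Reading (x , y) as x + y ω in 𝔽₄ = 𝔽₂[ω]/(ω² + ω + 1), this is multiplication by ω.
ω : 𝔽₂² → 𝔽₂²
ω (x , y) = y , x xor y

ω^ : ℕ → 𝔽₂² → 𝔽₂²
ω^ n u = iterate ω u n

ω^-𝟘 : ∀ n → ω^ n 𝟘 ≡ 𝟘
ω^-𝟘 zero    = refl
ω^-𝟘 (suc n) = ω^-𝟘 n

ω^-nonzero : ∀ n {u} → u ≢ 𝟘 → ω^ n u ≢ 𝟘
ω^-nonzero zero    u≢𝟘 = u≢𝟘
ω^-nonzero (suc n) {u} u≢𝟘 = ω^-nonzero n (ω-nonzero u u≢𝟘)
  where
  ω-nonzero : ∀ u → u ≢ 𝟘 → ω u ≢ 𝟘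
  ω-nonzero (false , false) u≢𝟘 = u≢𝟘
  ω-nonzero (false , true)  _   ()
  ω-nonzero (true  , false) _   ()
  ω-nonzero (true  , true)  _   ()

ω^-free : ∀ {u} → u ≢ 𝟘 → ∀ (c c′ : Fin 3) → ω^ (toℕ c) u ≡ ω^ (toℕ c′) u → c ≡ c′
ω^-free {u} u≢𝟘 c c′ eq = trans (sym (log-ω^ u≢𝟘 c)) (trans (cong (log u) eq) (log-ω^ u≢𝟘 c′))
  where
  log : 𝔽₂² → 𝔽₂² → Fin 3
  log u w = if does (Product.≡-dec Bool._≟_ Bool._≟_ w u) then zero
            else if does (Product.≡-dec Bool._≟_ Bool._≟_ w (ω u)) then suc zero else suc (suc zero)
  log-ω^ : ∀ {u} → u ≢ 𝟘 → ∀ c → log u (ω^ (toℕ c) u) ≡ c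
  log-ω^ {false , false} u≢𝟘 _ = ⊥-elim (u≢𝟘 refl)
  log-ω^ {false , true}  _ zero             = refl
  log-ω^ {false , true}  _ (suc zero)       = refl
  log-ω^ {false , true}  _ (suc (suc zero)) = refl
  log-ω^ {true  , false} _ zero             = refl
  log-ω^ {true  , false} _ (suc zero)       = refl
  log-ω^ {true  , false} _ (suc (suc zero)) = refl
  log-ω^ {true  , true}  _ zero             = refl
  log-ω^ {true  , true}  _ (suc zero)       = refl
  log-ω^ {true  , true}  _ (suc (suc zero)) = refl

_+²_ : ℤ × ℤ → ℤ × ℤ → ℤ × ℤ
(p , q) +² (p′ , q′) = p + p′ , q + q′

ωℤ : ℤ × ℤ → ℤ × ℤ
ωℤ (p , q) = q , p + q

ωℤ^ : ℕ → ℤ × ℤ → ℤ × ℤ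
ωℤ^ n v = iterate ωℤ v n

parity² : ℤ × ℤ → 𝔽₂²
parity² (p , q) = odd p , odd q

parity²-+² : ∀ v w → parity² (v +² w) ≡ parity² v ⊕ parity² w
parity²-+² (p , q) (p′ , q′) = cong₂ _,_ (odd-+ p p′) (odd-+ q q′)

parity²-ωℤ^ : ∀ n v → parity² (ωℤ^ n v) ≡ ω^ n (parity² v)
parity²-ωℤ^ zero    v       = refl
parity²-ωℤ^ (suc n) (p , q) = trans (parity²-ωℤ^ n (q , p + q)) (cong (λ b → ω^ n (odd q , b)) (odd-+ p q))

small-pair : ∀ {a b} → ∣ a ∣ ℕ.< 2 → ∣ b ∣ ℕ.< 2 → ∣ a + + 2 * b ∣ ℕ.< 4
small-pair {a} {b} |a|<2 |b|<2 = ℕ.≤-<-trans (ℤ.∣i+j∣≤∣i∣+∣j∣ a (+ 2 * b)) (s≤s (ℕ.+-mono-≤ (ℕ.≤-pred |a|<2) |2b|≤2))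
  where
  |2b|≤2 : ∣ + 2 * b ∣ ℕ.≤ 2
  |2b|≤2 = subst (ℕ._≤ 2) (sym (ℤ.∣i*j∣≡∣i∣*∣j∣ (+ 2) b)) (ℕ.*-monoʳ-≤ 2 (ℕ.≤-pred |b|<2))

small-pair-zero : ∀ {a b} → ∣ a ∣ ℕ.< 2 → a + + 2 * b ≡ 0ℤ → a ≡ 0ℤ × b ≡ 0ℤ
small-pair-zero {a} {b} |a|<2 eq =
  a≡0 , ℤ.*-cancelˡ-≡ (+ 2) b 0ℤ (trans (sym (ℤ.+-identityˡ _)) (trans (cong (_+ + 2 * b) (sym a≡0)) eq))
  where
  isolate : ∀ a b → a ≡ (a + + 2 * b) + - b * + 2
  isolate = solve-∀
  a≡0 : a ≡ 0ℤ
  a≡0 = small-divisible⇒0 |a|<2 (divides (- b) (trans (isolate a b) (trans (cong (_+ - b * + 2) eq) (ℤ.+-identityˡ _))))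

module _ (Γ : Graph) where

  IsCirculation² : (Edge Γ → ℤ × ℤ) → Set
  IsCirculation² v = IsCirculation Γ (proj₁ ∘ v) × IsCirculation Γ (proj₂ ∘ v)

  +²-circulation : ∀ {v w} → IsCirculation² v → IsCirculation² w → IsCirculation² (λ e → v e +² w e)
  +²-circulation (v₁ , v₂) (w₁ , w₂) = +-circulation Γ v₁ w₁ , +-circulation Γ v₂ w₂

  ωℤ^-circulation : ∀ n {v} → IsCirculation² v → IsCirculation² (λ e → ωℤ^ n (v e))
  ωℤ^-circulation zero    circulation      = circulation
  ωℤ^-circulation (suc n) (v₁ , v₂) = ωℤ^-circulation n (v₂ , +-circulation Γ v₁ v₂)

  -- A nowhere-zero ℤ₂²-flow on S, given by integer representatives.
  record NZFlow₂² (S : Subset (ne Γ)) : Set where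
    constructor nzFlow₂²
    field
      value       : Edge Γ → ℤ × ℤ
      circulation : IsCirculation² value
      zero-off    : ∀ e → e ∉ S → parity² (value e) ≡ 𝟘
      nonzero-on  : ∀ e → e ∈ S → parity² (value e) ≢ 𝟘

  NZFlow⇒NZFlow₂² : ∀ {S} → NZFlow Γ 4 S → NZFlow₂² S
  NZFlow⇒NZFlow₂² {S} (nzFlow f circulation zero-off nonzero-on bounded) =
    halve-remainder (lift-mod {Γ} 2 f (λ x → divides 0ℤ (circulation x)))
    where
    halve-remainder : LiftMod Γ 2 f → NZFlow₂² S
    halve-remainder (χ , circulation-χ , 2∣χ-f , |χ|<2) =
      nzFlow₂² (λ e → f e , β e) (circulation , circulation-β) zero-off² nonzero-on²
     where
     2∣f-χ : ∀ e → + 2 ∣ f e - χ e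
     2∣f-χ e = subst (+ 2 ∣_) (negate (χ e) (f e)) (∣m⇒∣-m (2∣χ-f e))
       where
       negate : ∀ a b → - (a - b) ≡ b - a
       negate = solve-∀
     β : Edge Γ → ℤ
     β e = _∣_.quotient (2∣f-χ e)
     2β≡f-χ : ∀ e → + 2 * β e ≡ f e + -1ℤ * χ e
     2β≡f-χ e = trans (ℤ.*-comm (+ 2) (β e)) (trans (sym (_∣_.equality (2∣f-χ e))) (minus (f e) (χ e)))
       where
       minus : ∀ a b → a - b ≡ a + -1ℤ * b
       minus = solve-∀
     circulation-β : IsCirculation Γ β
     circulation-β x = ℤ.*-cancelˡ-≡ (+ 2) (∂ Γ β x) 0ℤ (begin
       + 2 * ∂ Γ β x                 ≡⟨ sym (∂-* Γ (+ 2) β x) ⟩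
       ∂ Γ (λ e → + 2 * β e) x      ≡⟨ circulation-cong Γ (sym ∘ 2β≡f-χ)
                                          (+-circulation Γ circulation (*-circulation Γ -1ℤ circulation-χ)) x ⟩
       0ℤ                           ∎)
       where open ≡-Reasoning
     χ≡0 : ∀ {e} → + 2 ∣ f e → χ e ≡ 0ℤ
     χ≡0 {e} 2∣f = congruent-zero (2∣χ-f e) 2∣f (|χ|<2 e)
     2β≡f : ∀ {e} → + 2 ∣ f e → + 2 * β e ≡ f e
     2β≡f {e} 2∣f = trans (2β≡f-χ e) (trans (cong (λ a → f e + -1ℤ * a) (χ≡0 2∣f)) (ℤ.+-identityʳ (f e)))
     zero-off² : ∀ e → e ∉ S → parity² (f e , β e) ≡ 𝟘
     zero-off² e e∉S = cong₂ _,_ (even⇒¬odd 2∣f) (even⇒¬odd (divides 0ℤ β≡0))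
       where
       2∣f : + 2 ∣ f e
       2∣f = subst (+ 2 ∣_) (sym (zero-off e e∉S)) (divides 0ℤ refl)
       β≡0 : β e ≡ 0ℤ
       β≡0 = ℤ.*-cancelˡ-≡ (+ 2) (β e) 0ℤ (trans (2β≡f 2∣f) (zero-off e e∉S))
     -- An even value of f on S is ±2, so that β is odd there.
     nonzero-on² : ∀ e → e ∈ S → parity² (f e , β e) ≢ 𝟘
     nonzero-on² e e∈S parity≡𝟘 = small-nonzero⇒∤ |β|<2 β≢0 (¬odd⇒even (β e) (cong proj₂ parity≡𝟘))
       where
       2∣f : + 2 ∣ f e
       2∣f = ¬odd⇒even (f e) (cong proj₁ parity≡𝟘)
       β≢0 : β e ≢ 0ℤ
       β≢0 β≡0 = nonzero-on e e∈S (trans (sym (2β≡f 2∣f)) (trans (cong (+ 2 *_) β≡0) refl))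
       |β|<2 : ∣ β e ∣ ℕ.< 2
       |β|<2 = ℕ.*-cancelˡ-< 2 ∣ β e ∣ 2
         (subst (ℕ._< 4) (trans (cong ∣_∣ (sym (2β≡f 2∣f))) (ℤ.∣i*j∣≡∣i∣*∣j∣ (+ 2) (β e))) (bounded e e∈S))

  NZFlow₂²⇒NZFlow : ∀ {S} → NZFlow₂² S → NZFlow Γ 4 S
  NZFlow₂²⇒NZFlow {S} (nzFlow₂² v (circulation₁ , circulation₂) zero-off nonzero-on) =
    combine (lift-mod {Γ} 2 (proj₁ ∘ v) (λ x → divides 0ℤ (circulation₁ x)))
            (lift-mod {Γ} 2 (proj₂ ∘ v) (λ x → divides 0ℤ (circulation₂ x)))
    where
    combine : LiftMod Γ 2 (proj₁ ∘ v) → LiftMod Γ 2 (proj₂ ∘ v) → NZFlow Γ 4 S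
    combine (χ₁ , circulation-χ₁ , 2∣χ₁-v₁ , |χ₁|<2) (χ₂ , circulation-χ₂ , 2∣χ₂-v₂ , |χ₂|<2) =
      nzFlow f (+-circulation Γ circulation-χ₁ (*-circulation Γ (+ 2) circulation-χ₂)) zero-off′ nonzero-on′
        (λ e _ → small-pair {a = χ₁ e} {b = χ₂ e} (|χ₁|<2 e) (|χ₂|<2 e))
     where
     f : Edge Γ → ℤ
     f e = χ₁ e + + 2 * χ₂ e
     zero-off′ : ∀ e → e ∉ S → f e ≡ 0ℤ
     zero-off′ e e∉S = cong₂ (λ a b → a + + 2 * b)
       (congruent-zero {a = χ₁ e} (2∣χ₁-v₁ e) (¬odd⇒even _ (cong proj₁ (zero-off e e∉S))) (|χ₁|<2 e))
       (congruent-zero {a = χ₂ e} (2∣χ₂-v₂ e) (¬odd⇒even _ (cong proj₂ (zero-off e e∉S))) (|χ₂|<2 e))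
     nonzero-on′ : ∀ e → e ∈ S → f e ≢ 0ℤ
     nonzero-on′ e e∈S f≡0 with small-pair-zero {a = χ₁ e} {b = χ₂ e} (|χ₁|<2 e) f≡0
     ... | χ₁≡0 , χ₂≡0 = nonzero-on e e∈S (cong₂ _,_ (even⇒¬odd (congruent-to-zero {a = χ₁ e} (2∣χ₁-v₁ e) χ₁≡0))
                                                     (even⇒¬odd (congruent-to-zero {a = χ₂ e} (2∣χ₂-v₂ e) χ₂≡0)))

  glue₂² : ∀ {S₁ S₂} → NZFlow₂² S₁ → NZFlow₂² S₂ → size (S₁ ∩ S₂) ℕ.≤ 2 → NZFlow₂² (S₁ ∪ S₂)
  glue₂² {S₁} {S₂}
    (nzFlow₂² v₁ circulation₁ zero-off₁ nonzero-on₁) (nzFlow₂² v₂ circulation₂ zero-off₂ nonzero-on₂) few =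
    glue-along (proj₁ chosen) (proj₂ chosen)
    where
    combination : Fin 3 → Edge Γ → ℤ × ℤ
    combination c e = v₁ e +² ωℤ^ (toℕ c) (v₂ e)
    parity-combination : ∀ c e → parity² (combination c e) ≡ parity² (v₁ e) ⊕ ω^ (toℕ c) (parity² (v₂ e))
    parity-combination c e = trans (parity²-+² (v₁ e) _) (cong (parity² (v₁ e) ⊕_) (parity²-ωℤ^ (toℕ c) (v₂ e)))
    Blocks : Edge Γ → Fin 3 → Set
    Blocks e c = e ∈ S₁ ∩ S₂ × parity² (combination c e) ≡ 𝟘
    unique : ∀ {e c c′} → Blocks e c → Blocks e c′ → c ≡ c′
    unique {e} {c} {c′} (e∈T , 𝟘≡) (_ , 𝟘≡′) = ω^-free (nonzero-on₂ e (proj₂ (x∈p∩q⁻ S₁ S₂ e∈T))) c c′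
      (⊕-cancel (parity² (v₁ e)) (trans (sym (parity-combination c e)) 𝟘≡) (trans (sym (parity-combination c′ e)) 𝟘≡′))
    chosen = unblocked-choice (S₁ ∩ S₂) Blocks
      (λ e c → (e ∈? S₁ ∩ S₂) ×-dec Product.≡-dec Bool._≟_ Bool._≟_ (parity² (combination c e)) 𝟘)
      proj₁ unique (s≤s few)
    glue-along : ∀ c → (∀ e → ¬ Blocks e c) → NZFlow₂² (S₁ ∪ S₂)
    glue-along c free = nzFlow₂² (combination c) (+²-circulation circulation₁ (ωℤ^-circulation (toℕ c) circulation₂))
      zero-off nonzero-on
      where
      zero-off : ∀ e → e ∉ S₁ ∪ S₂ → parity² (combination c e) ≡ 𝟘
      zero-off e e∉S = trans (parity-combination c e)
        (cong₂ _⊕_ (zero-off₁ e (e∉S ∘ x∈p∪q⁺ ∘ inj₁))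
                   (trans (cong (ω^ (toℕ c)) (zero-off₂ e (e∉S ∘ x∈p∪q⁺ ∘ inj₂))) (ω^-𝟘 (toℕ c))))
      nonzero-on : ∀ e → e ∈ S₁ ∪ S₂ → parity² (combination c e) ≢ 𝟘
      nonzero-on e e∈S with e ∈? S₁ | e ∈? S₂
      ... | yes e∈S₁ | yes e∈S₂ = λ 𝟘≡ → free e (x∈p∩q⁺ (e∈S₁ , e∈S₂) , 𝟘≡)
      ... | yes e∈S₁ | no e∉S₂  = nonzero-on₁ e e∈S₁ ∘ trans (sym only₁)
        where
        only₁ : parity² (combination c e) ≡ parity² (v₁ e)
        only₁ = trans (parity-combination c e)
          (trans (cong (λ u → parity² (v₁ e) ⊕ ω^ (toℕ c) u) (zero-off₂ e e∉S₂))
                 (trans (cong (parity² (v₁ e) ⊕_) (ω^-𝟘 (toℕ c))) (⊕-identityʳ (parity² (v₁ e)))))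
      ... | no e∉S₁ | yes e∈S₂  = ω^-nonzero (toℕ c) (nonzero-on₂ e e∈S₂) ∘ trans (sym only₂)
        where
        only₂ : parity² (combination c e) ≡ ω^ (toℕ c) (parity² (v₂ e))
        only₂ = trans (parity-combination c e) (cong (_⊕ ω^ (toℕ c) (parity² (v₂ e))) (zero-off₁ e e∉S₁))
      ... | no e∉S₁ | no e∉S₂   = ⊥-elim ([ e∉S₁ , e∉S₂ ]′ (x∈p∪q⁻ S₁ S₂ e∈S))

  four-glues : Glues Γ 4
  four-glues φ₁ φ₂ few = NZFlow₂²⇒NZFlow (glue₂² (NZFlow⇒NZFlow₂² φ₁) (NZFlow⇒NZFlow₂² φ₂) few)

-- Gluing a sequence of subgraphs

module _ {m : ℕ} where

  unionBelow-zero : ∀ {n} (S : Fin n → Subset m) → unionBelow S 0 ≡ ⊥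
  unionBelow-zero {zero}  S = refl
  unionBelow-zero {suc n} S = refl

  unionBelow-suc : ∀ {n} (S : Fin n → Subset m) (l : Fin n) → unionBelow S (suc (toℕ l)) ≡ unionBelow S (toℕ l) ∪ S l
  unionBelow-suc S zero    = trans (cong (S zero ∪_) (unionBelow-zero (S ∘ suc)))
                                   (trans (∪-identityʳ (S zero)) (sym (∪-identityˡ (S zero))))
  unionBelow-suc S (suc l) = trans (cong (S zero ∪_) (unionBelow-suc (S ∘ suc) l)) (sym (∪-assoc (S zero) _ _))

  ∈-unionBelow : ∀ {n} (S : Fin n → Subset m) {l e} i → toℕ i ℕ.< l → e ∈ S i → e ∈ unionBelow S l
  ∈-unionBelow S {suc l} zero    _         e∈S = x∈p∪q⁺ (inj₁ e∈S)
  ∈-unionBelow S {suc l} (suc i) (s≤s i<l) e∈S = x∈p∪q⁺ (inj₂ (∈-unionBelow (S ∘ suc) i i<l e∈S))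

  unionBelow-covers : ∀ {n} (S : Fin n → Subset m) → (∀ e → ∃ λ i → e ∈ S i) → unionBelow S n ≡ ⊤
  unionBelow-covers S covers =
    ⊆-antisym (λ _ → ∈⊤) λ {e} _ → ∈-unionBelow S (proj₁ (covers e)) (toℕ<n _) (proj₂ (covers e))

empty-NZFlow : ∀ {Γ k} → NZFlow Γ k ⊥
empty-NZFlow {Γ} = nzFlow (λ _ → 0ℤ) (zero-circulation Γ) (λ _ _ → refl) (λ _ → ⊥-elim ∘ ∉⊥) (λ _ → ⊥-elim ∘ ∉⊥)

-- Overlaps with the empty union are empty, so the case l = 0 excluded by the hypothesis holds anyway.
overlaps-from-0 : ∀ {m n b} (S : Fin n → Subset m) →
  (∀ (l : Fin n) → 1 ℕ.≤ toℕ l → size (unionBelow S (toℕ l) ∩ S l) ℕ.≤ b) →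
  ∀ (l : Fin n) → size (unionBelow S (toℕ l) ∩ S l) ℕ.≤ b
overlaps-from-0 {m} S overlaps l with toℕ l | overlaps l
... | zero  | _       = subst (ℕ._≤ _) (sym (trans (cong (λ T → size (T ∩ S l)) (unionBelow-zero S))
                          (trans (cong size (∩-zeroˡ (S l))) (∣⊥∣≡0 m)))) z≤n
... | suc _ | bounded = bounded (s≤s z≤n)

glue-family : ∀ {Γ k n} → Glues Γ k → (S : Fin n → Subset (ne Γ)) → (∀ i → NZFlow Γ k (S i)) →
  (∀ (l : Fin n) → size (unionBelow S (toℕ l) ∩ S l) ℕ.≤ k ∸ 2) →
  ∀ l → l ℕ.≤ n → NZFlow Γ k (unionBelow S l)
glue-family {Γ} {k} glues S flows overlaps zero    _   = subst (NZFlow Γ k) (sym (unionBelow-zero S)) empty-NZFlow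
glue-family {Γ} {k} glues S flows overlaps (suc l) l<n =
  subst (NZFlow Γ k) U∪Sᵢ≡U (glues (glue-family glues S flows overlaps l (ℕ.<⇒≤ l<n)) (flows i) small-overlap)
  where
  i : Fin _
  i = fromℕ< l<n
  U∪Sᵢ≡U : unionBelow S l ∪ S i ≡ unionBelow S (suc l)
  U∪Sᵢ≡U = subst (λ j → unionBelow S j ∪ S i ≡ unionBelow S (suc j)) (toℕ-fromℕ< l<n) (sym (unionBelow-suc S i))
  small-overlap : size (unionBelow S l ∩ S i) ℕ.≤ k ∸ 2
  small-overlap = subst (λ j → size (unionBelow S j ∩ S i) ℕ.≤ k ∸ 2) (toℕ-fromℕ< l<n) (overlaps i)

corollary3p6 : (Γ : Graph) (k : ℕ) → (k ≡ 3 ⊎ k ≡ 4 ⊎ k ≡ 5) →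
    (n : ℕ) → 2 ℕ.≤ n → (Γs : Fin n → Subgraph Γ) →
    (∀ x → ∃ λ i → x ∈ V (Γs i)) →
    (∀ e → ∃ λ i → e ∈ E (Γs i)) →
    (∀ i → HasNZkFlow Γ (Γs i) k) →
    (∀ (l : Fin n) → 1 ℕ.≤ toℕ l →
      size (unionBelow (λ i → E (Γs i)) (toℕ l) ∩ E (Γs l)) ℕ.≤ k ∸ 2) →
    HasNZkFlow Γ (whole Γ) k
corollary3p6 Γ k k∈345 n _ Γs _ edges-covered flows overlaps =
  NZFlow⇒HasNZkFlow (subst (NZFlow Γ k) (unionBelow-covers S edges-covered)
    (glue-family (glues k∈345) S (λ i → HasNZkFlow⇒NZFlow (Γs i) k (flows i)) (overlaps-from-0 S overlaps) n ℕ.≤-refl))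
  where
  S : Fin n → Subset (ne Γ)
  S i = E (Γs i)
  glues : ∀ {k} → k ≡ 3 ⊎ k ≡ 4 ⊎ k ≡ 5 → Glues Γ k
  glues (inj₁ refl)        = prime-glues (from-yes (prime? 3))
  glues (inj₂ (inj₁ refl)) = four-glues Γ
  glues (inj₂ (inj₂ refl)) = prime-glues (from-yes (prime? 5))
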